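{- Let $M$ be a structure, $N\subseteq M$, $X\subseteq\mathcal X$, and let $\varphi$ be a formula such that $\pi_X(\|\varphi\|_M)\subseteq N^X$. Then $\pi_{\mathrm{cl}_{eq(\varphi)}(X)}(\|\varphi\|_M)\subseteq N^{\mathrm{cl}_{eq(\varphi)}(X)}$.
   Context: Language: finite set $\mathcal R$ of relation symbols with arities $\delta(r)$; finite set $\mathcal X$ of variables. Formulas: $1$; $r(x_1,\ldots,x_n)$; $(x\approx y)$; $\neg\varphi$; $\varphi\wedge\psi$; $\varphi\vee\psi$; $(\exists x)\varphi$. A structure $M$: nonempty finite set $M$ with $r^M\subseteq M^{\delta(r)}$. $\mathcal V=M^{\mathcal X}$, $\overline V=\mathcal V\setminus V$, $\mathrm C_x(V)=\{v:\exists u\in V,\ u(z)=v(z)\ \forall z\neq x\}$, $\mathrm D_{xy}=\{v:v(x)=v(y)\}$. Value: $\|1\|=\mathcal V$, $\|r(x_1,\ldots,x_n)\|=\{v:(v(x_1),\ldots,v(x_n))\in r^M\}$, $\|x\approx y\|=\mathrm D_{xy}$, $\|\neg\varphi\|=\overline{\|\varphi\|}$, $\wedge\mapsto\cap$, $\vee\mapsto\cup$, $\|(\exists x)\varphi\|=\mathrm C_x(\|\varphi\|)$. For $V\subseteq\mathcal V$, $\pi_X(V)=\{v|_X:v\in V\}$. $\mathrm{Eq}(R)$ is the least equivalence on $\mathcal X$ containing $R$; $\mathrm{id}_{\mathcal X}$ the identity. With $\varphi\vee\psi$ treated as $\neg(\neg\varphi\wedge\neg\psi)$: $eq(1)=coeq(1)=eq(r(\ldots))=coeq(r(\ldots))=coeq(x\approx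 y)=\mathrm{id}_{\mathcal X}$, $eq(x_1\approx x_2)=\mathrm{Eq}(\{\langle x_1,x_2\rangle\})$; $eq(\neg\varphi)=coeq(\varphi)$, $coeq(\neg\varphi)=eq(\varphi)$; $eq(\varphi\wedge\psi)=\mathrm{Eq}(eq(\varphi)\cup eq(\psi))$, $coeq(\varphi\wedge\psi)=coeq(\varphi)\cap coeq(\psi)$; $eq((\exists x)\varphi)=\mathrm{Eq}(eq(\varphi)\cap(\mathcal X\setminus\{x\})^2)$, likewise $coeq$. For an equivalence $E$, $\mathrm{cl}_E(X)=\{y:\langle x,y\rangle\in E\text{ for some }x\in X\}$. -}

module Defs where

open import Data.Nat using (ℕ; suc)
open import Data.Fin using (Fin)
open import Data.Vec using (Vec; map)
open import Data.Product using (Σ; ∃; _×_)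
open import Data.Sum using (_⊎_)
open import Relation.Nullary using (¬_)
open import Relation.Binary.PropositionalEquality using (_≡_; _≢_)

record Language : Set where
  field
    nRel : ℕ
    δ    : Fin nRel → ℕ
open Language public

Var : ℕ → Set
Var k = Fin k

data Formula (L : Language) (k : ℕ) : Set where
  top  : Formula L k
  rel  : (r : Fin (nRel L)) → Vec (Fin k) (δ L r) → Formula L k
  eqv  : Fin k → Fin k → Formula L k
  neg  : Formula L k → Formula L k
  conj : Formula L k → Formula L k → Formula L k
  disj : Formula L k → Formula L k → Formula L k
  ex   : Fin k → Formula L k → Formula L k

record Structure (L : Language) : Set₁ where
  field
    size   : ℕ
    interp : (r : Fin (nRel L)) → Vec (Fin (suc size)) (δ L r) → Set
open Structure public

Carrier : {L : Language} → Structure L → Set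
Carrier M = Fin (suc (size M))

Valuation : {L : Language} → Structure L → ℕ → Set
Valuation M k = Fin k → Carrier M

Pred : Set → Set₁
Pred A = A → Set

Cyl : {L : Language} {M : Structure L} {k : ℕ} →
      Fin k → Pred (Valuation M k) → Pred (Valuation M k)
Cyl x V v = Σ _ λ u → V u × (∀ z → z ≢ x → u z ≡ v z)

Diag : {L : Language} {M : Structure L} {k : ℕ} →
       Fin k → Fin k → Pred (Valuation M k)
Diag x y v = v x ≡ v y

⟦_⟧ : {L : Language} {k : ℕ} → Formula L k → (M : Structure L) → Pred (Valuation M k)
⟦ top ⟧ M v = Data.Unit.⊤ where import Data.Unit
⟦ rel r xs ⟧ M v = interp M r (map v xs)
⟦ eqv x y ⟧ M v = Diag {M = M} x y v
⟦ neg φ ⟧ M v = ¬ (⟦ φ ⟧ M v)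
⟦ conj φ ψ ⟧ M v = ⟦ φ ⟧ M v × ⟦ ψ ⟧ M v
⟦ disj φ ψ ⟧ M v = ⟦ φ ⟧ M v ⊎ ⟦ ψ ⟧ M v
⟦ ex x φ ⟧ M v = Cyl {M = M} x (⟦ φ ⟧ M) v

Rel : ℕ → Set₁
Rel k = Fin k → Fin k → Set

data EqClo {k : ℕ} (R : Rel k) : Rel k where
  base  : ∀ {x y} → R x y → EqClo R x y
  refl′ : ∀ {x} → EqClo R x x
  sym′  : ∀ {x y} → EqClo R x y → EqClo R y x
  trans′ : ∀ {x y z} → EqClo R x y → EqClo R y z → EqClo R x z

IdRel : {k : ℕ} → Rel k
IdRel x y = x ≡ y

_∪R_ : {k : ℕ} → Rel k → Rel k → Rel k
(R ∪R S) x y = R x y ⊎ S x y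

_∩R_ : {k : ℕ} → Rel k → Rel k → Rel k
(R ∩R S) x y = R x y × S x y

avoid : {k : ℕ} → Fin k → Rel k → Rel k
avoid x R y z = R y z × y ≢ x × z ≢ x

-- eq and coeq (φ ∨ ψ treated as ¬(¬φ ∧ ¬ψ)), so that
-- eq(φ∨ψ) = eq φ ∩ eq ψ and coeq(φ∨ψ) = Eq(coeq φ ∪ coeq ψ).
eq   : {L : Language} {k : ℕ} → Formula L k → Rel k
coeq : {L : Language} {k : ℕ} → Formula L k → Rel k
eq top = IdRel
eq (rel r xs) = IdRel
eq (eqv x₁ x₂) = EqClo (λ a b → a ≡ x₁ × b ≡ x₂)
eq (neg φ) = coeq φ
eq (conj φ ψ) = EqClo (eq φ ∪R eq ψ)
eq (disj φ ψ) = eq φ ∩R eq ψ   -- = coeq(¬φ ∧ ¬ψ) = coeq(¬φ) ∩ coeq(¬ψ)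
eq (ex x φ) = EqClo (avoid x (eq φ))
coeq top = IdRel
coeq (rel r xs) = IdRel
coeq (eqv x y) = IdRel
coeq (neg φ) = eq φ
coeq (conj φ ψ) = coeq φ ∩R coeq ψ
coeq (disj φ ψ) = EqClo (coeq φ ∪R coeq ψ)   -- = eq(¬φ ∧ ¬ψ) = Eq(eq(¬φ) ∪ eq(¬ψ))
coeq (ex x φ) = EqClo (avoid x (coeq φ))

cl : {k : ℕ} → Rel k → Pred (Fin k) → Pred (Fin k)
cl E X y = Σ _ λ x → X x × E x y

PartialVal : {L : Language} → Structure L → {k : ℕ} → Pred (Fin k) → Set
PartialVal M {k} X = (x : Fin k) → X x → Carrier M

π : {L : Language} {M : Structure L} {k : ℕ} (X : Pred (Fin k)) →
    Pred (Valuation M k) → Pred (PartialVal M X)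
π X V w = Σ _ λ v → V v × (∀ x (p : X x) → w x p ≡ v x)

Pow : {L : Language} {M : Structure L} {k : ℕ} →
      Pred (Carrier M) → (X : Pred (Fin k)) → Pred (PartialVal M X)
Pow N X w = ∀ x (p : X x) → N (w x p)

_⊆_ : {A : Set} → Pred A → Pred A → Set
P ⊆ Q = ∀ a → P a → Q a

-- A valuation satisfying φ identifies all pairs of variables related by eq φ, and a
-- valuation refuting φ identifies all pairs related by coeq φ (simultaneous induction
-- on φ; the coeq cases for ¬ and ∧ use that equality in the finite carrier is
-- stable under double negation). So if v ∈ ‖φ‖ and y ∈ cl_{eq φ}(X) via x ∈ X, then
-- v y = v x, and v x ∈ N because the restriction of v to X lies in π_X(‖φ‖).
module Submission where

open import Defs
open import Data.Nat using (ℕ)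
open import Data.Fin using (Fin)
open import Data.Fin.Properties using (_≟_)
open import Data.Product using (_,_)
open import Data.Sum using (inj₁; inj₂)
open import Relation.Nullary using (¬_)
open import Relation.Nullary.Decidable using (decidable-stable)
open import Relation.Binary.PropositionalEquality using (_≡_; refl; sym; trans; subst)

module _ {L : Language} {k : ℕ} {M : Structure L} where

  Equates : Valuation M k → Rel k → Set
  Equates v R = ∀ {a b} → R a b → v a ≡ v b

  EqClo-equates : ∀ {v R} → Equates v R → Equates v (EqClo R)
  EqClo-equates v≈ (base r)      = v≈ r
  EqClo-equates v≈ refl′         = refl
  EqClo-equates v≈ (sym′ e)      = sym (EqClo-equates v≈ e)
  EqClo-equates v≈ (trans′ e e′) = trans (EqClo-equates v≈ e) (EqClo-equates v≈ e′)

  ≡-stable : {c d : Carrier M} → ¬ ¬ c ≡ d → c ≡ d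
  ≡-stable {c} {d} = decidable-stable (c ≟ d)

  ⊆-Cyl : ∀ {x} {V : Pred (Valuation M k)} → V ⊆ Cyl {M = M} x V
  ⊆-Cyl v v∈V = v , v∈V , λ _ _ → refl

  satisfies⇒equates-eq  : ∀ φ {v} → ⟦ φ ⟧ M v → Equates v (eq φ)
  refutes⇒equates-coeq : ∀ φ {v} → ¬ ⟦ φ ⟧ M v → Equates v (coeq φ)

  satisfies⇒equates-eq top        _ refl = refl
  satisfies⇒equates-eq (rel r xs) _ refl = refl
  satisfies⇒equates-eq (eqv x y) v⊨ =
    EqClo-equates λ { (refl , refl) → v⊨ }
  satisfies⇒equates-eq (neg φ) v⊨ = refutes⇒equates-coeq φ v⊨
  satisfies⇒equates-eq (conj φ ψ) (v⊨φ , v⊨ψ) = EqClo-equates λ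
    { (inj₁ e) → satisfies⇒equates-eq φ v⊨φ e
    ; (inj₂ e) → satisfies⇒equates-eq ψ v⊨ψ e }
  satisfies⇒equates-eq (disj φ ψ) (inj₁ v⊨φ) (e , _) = satisfies⇒equates-eq φ v⊨φ e
  satisfies⇒equates-eq (disj φ ψ) (inj₂ v⊨ψ) (_ , e) = satisfies⇒equates-eq ψ v⊨ψ e
  satisfies⇒equates-eq (ex x φ) (u , u⊨φ , u≈v) = EqClo-equates λ
    { (e , a≢x , b≢x) →
        trans (sym (u≈v _ a≢x)) (trans (satisfies⇒equates-eq φ u⊨φ e) (u≈v _ b≢x)) }

  refutes⇒equates-coeq top        _ refl = refl
  refutes⇒equates-coeq (rel r xs) _ refl = refl
  refutes⇒equates-coeq (eqv x y)  _ refl = refl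
  refutes⇒equates-coeq (neg φ) v⊭¬φ e =
    ≡-stable λ v≉ → v⊭¬φ λ v⊨φ → v≉ (satisfies⇒equates-eq φ v⊨φ e)
  refutes⇒equates-coeq (conj φ ψ) v⊭φ∧ψ (eφ , eψ) = ≡-stable λ v≉ →
    let ¬¬v⊨ψ : ¬ ¬ ⟦ ψ ⟧ M _
        ¬¬v⊨ψ = λ v⊭ψ → v≉ (refutes⇒equates-coeq ψ v⊭ψ eψ)
    in v≉ (refutes⇒equates-coeq φ (λ v⊨φ → ¬¬v⊨ψ λ v⊨ψ → v⊭φ∧ψ (v⊨φ , v⊨ψ)) eφ)
  refutes⇒equates-coeq (disj φ ψ) v⊭φ∨ψ = EqClo-equates λ
    { (inj₁ e) → refutes⇒equates-coeq φ (λ v⊨φ → v⊭φ∨ψ (inj₁ v⊨φ)) e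
    ; (inj₂ e) → refutes⇒equates-coeq ψ (λ v⊨ψ → v⊭φ∨ψ (inj₂ v⊨ψ)) e }
  refutes⇒equates-coeq (ex x φ) v⊭∃φ = EqClo-equates λ
    { (e , _) → refutes⇒equates-coeq φ (λ v⊨φ → v⊭∃φ (⊆-Cyl _ v⊨φ)) e }

  restriction∈π : ∀ (X : Pred (Fin k)) {V} {v} → V v → π {M = M} X V (λ x _ → v x)
  restriction∈π X {v = v} v∈V = v , v∈V , λ _ _ → refl

lemma5p5 : {L : Language} {k : ℕ} (M : Structure L) (N : Pred (Carrier M))
    (X : Pred (Fin k)) (φ : Formula L k) →
    π {M = M} X (⟦ φ ⟧ M) ⊆ Pow {M = M} N X →
    π {M = M} (cl (eq φ) X) (⟦ φ ⟧ M) ⊆ Pow {M = M} N (cl (eq φ) X)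
lemma5p5 M N X φ πX⊆NX w (v , v⊨φ , w≡v) y y∈cl@(x , x∈X , e) =
  subst N v-x≡w-y (πX⊆NX _ (restriction∈π {M = M} X v⊨φ) x x∈X)
  where
  v-x≡w-y : v x ≡ w y y∈cl
  v-x≡w-y = trans (satisfies⇒equates-eq φ v⊨φ e) (sym (w≡v y y∈cl))
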